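{- Let $T$ be a basic $n$-tournament with $V(T)=\{v_1,\ldots,v_n\}$, let $u\notin V(T)$, let $\sigma$ be a dominating relation between $u$ and $V(T)$, and let $T(u,\sigma)$ be the tournament generated by $T$ and $u$ with $\sigma$. If there exists $v_i\in V(T)$ such that $u$ and $v_i$ are CR-associated vertices in $T(u,\sigma)$, then for every $j\in\{1,\ldots,n\}\setminus\{i\}$, $u$ and $v_j$ are not CR-associated vertices in $T(u,\sigma)$.
   Context: A tournament is a digraph with exactly one arc between each pair of distinct vertices. For distinct vertices write $\theta_T(u,v)=1$ if $u\to v$, $-1$ otherwise. Two vertices $w_1,w_2$ of a tournament $R$ with $|V(R)|\ge3$ are covertices if $\theta_R(w_1,v)=\theta_R(w_2,v)$ for all other $v$, revertices if $\theta_R(w_1,v)=-\theta_R(w_2,v)$ for all other $v$, CR-associated if either. A tournament of order at least 4 is basic if no two of its vertices are CR-associated. A dominating relation between $u$ and $V(T)=\{v_1,\dots,v_n\}$ is $\sigma=(r_1,\dots,r_n)\in\{1,-1\}^n$, and $T(u,\sigma)$ is the tournament on $V(T)\cup\{u\}$ extending $T$ with $u\to v_i$ iff $r_i=1$. -}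

module Defs where

open import Data.Nat using (ℕ; suc; _≥_)
open import Data.Fin using (Fin; zero; suc)
open import Data.Bool using (Bool; true; false; not)
open import Data.Product using (_×_)
open import Data.Sum using (_⊎_)
open import Relation.Binary.PropositionalEquality using (_≡_; _≢_)
open import Relation.Nullary using (¬_)

-- A digraph on the vertex set Fin n, given by its arc predicate:
-- arc u v ≡ true  means  u → v.
-- (Arc values on the diagonal are irrelevant and never inspected.)
record Tournament (n : ℕ) : Set where
  field
    arc : Fin n → Fin n → Bool
    tour : ∀ u v → u ≢ v → arc v u ≡ not (arc u v)
open Tournament public

-- θ_T(u,v) is encoded as the Bool  arc T u v  (true ↔ 1, false ↔ -1).

Covertices : ∀ {n} → Tournament n → Fin n → Fin n → Set
Covertices {n} R w₁ w₂ =
  n ≥ 3 × w₁ ≢ w₂ × (∀ v → v ≢ w₁ → v ≢ w₂ → arc R w₁ v ≡ arc R w₂ v)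

Revertices : ∀ {n} → Tournament n → Fin n → Fin n → Set
Revertices {n} R w₁ w₂ =
  n ≥ 3 × w₁ ≢ w₂ × (∀ v → v ≢ w₁ → v ≢ w₂ → arc R w₁ v ≡ not (arc R w₂ v))

CRAssociated : ∀ {n} → Tournament n → Fin n → Fin n → Set
CRAssociated R w₁ w₂ = Covertices R w₁ w₂ ⊎ Revertices R w₁ w₂

Basic : ∀ {n} → Tournament n → Set
Basic {n} T = n ≥ 4 × (∀ w₁ w₂ → ¬ CRAssociated T w₁ w₂)

-- Dominating relation σ between u and V(T): σ i = true means r_i = 1 (u → v_i).
DomRel : ℕ → Set
DomRel n = Fin n → Bool

-- T(u,σ): vertex set Fin (suc n), the new vertex u is  zero, v_i is  suc i.
extArc : ∀ {n} → Tournament n → DomRel n → Fin (suc n) → Fin (suc n) → Bool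
extArc T σ zero    zero    = false
extArc T σ zero    (suc j) = σ j
extArc T σ (suc i) zero    = not (σ i)
extArc T σ (suc i) (suc j) = arc T i j

private
  suc≢ : ∀ {n} {i j : Fin n} → suc i ≢ suc j → i ≢ j
  suc≢ p refl' = p (Relation.Binary.PropositionalEquality.cong suc refl')

  notnot : ∀ b → b ≡ not (not b)
  notnot true = Relation.Binary.PropositionalEquality.refl
  notnot false = Relation.Binary.PropositionalEquality.refl

extTour : ∀ {n} (T : Tournament n) (σ : DomRel n) u v → u ≢ v →
          extArc T σ v u ≡ not (extArc T σ u v)
extTour T σ zero zero p = Data.Empty.⊥-elim (p Relation.Binary.PropositionalEquality.refl)
  where import Data.Empty
extTour T σ zero (suc j) p = Relation.Binary.PropositionalEquality.refl
extTour T σ (suc i) zero p = notnot (σ i)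
extTour T σ (suc i) (suc j) p = tour T i j (suc≢ p)

_⟨_⟩ : ∀ {n} → Tournament n → DomRel n → Tournament (suc n)
T ⟨ σ ⟩ = record { arc = extArc T σ ; tour = extTour T σ }

{-# OPTIONS --safe #-}
-- If u is CR-associated with v_i in T(u,σ), then away from v_i the relation σ
-- equals the row of v_i in T or its negation. Were u also CR-associated with
-- some v_j, the rows of v_i and v_j would then agree or be opposite away from
-- v_i and v_j, so v_i and v_j would be CR-associated in T, which is not basic.
module Submission where

open import Defs
open import Data.Nat using (ℕ; _≥_)
open import Data.Nat.Properties using (<⇒≤)
open import Data.Fin using (Fin; zero; suc)
open import Data.Fin.Properties using (suc-injective)
open import Data.Bool using (Bool; true; false; _xor_)
open import Data.Bool.Properties using (xor-same; xor-assoc)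
open import Data.Product using (∃; _,_)
open import Data.Sum using (inj₁; inj₂)
open import Function using (_∘_)
open import Relation.Binary.PropositionalEquality
  using (_≡_; _≢_; sym; trans; cong; module ≡-Reasoning)
open import Relation.Nullary using (¬_)

-- The sign s is false for covertices and true for revertices, since
-- false xor b = b and true xor b = not b hold by definition.
SignedAssociated : ∀ {n} → Tournament n → Bool → Fin n → Fin n → Set
SignedAssociated R s w₁ w₂ =
  ∀ v → v ≢ w₁ → v ≢ w₂ → arc R w₁ v ≡ s xor arc R w₂ v

CRAssociated⇒signed : ∀ {n} (R : Tournament n) {w₁ w₂} →
  CRAssociated R w₁ w₂ → ∃ λ s → SignedAssociated R s w₁ w₂
CRAssociated⇒signed _ (inj₁ (_ , _ , co)) = false , co
CRAssociated⇒signed _ (inj₂ (_ , _ , re)) = true , re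

signed⇒CRAssociated : ∀ {n} (R : Tournament n) {w₁ w₂} s → n ≥ 3 → w₁ ≢ w₂ →
  SignedAssociated R s w₁ w₂ → CRAssociated R w₁ w₂
signed⇒CRAssociated _ false n≥3 w₁≢w₂ co = inj₁ (n≥3 , w₁≢w₂ , co)
signed⇒CRAssociated _ true  n≥3 w₁≢w₂ re = inj₂ (n≥3 , w₁≢w₂ , re)

xor-transfer : ∀ s t a b → s xor a ≡ t xor b → a ≡ (s xor t) xor b
xor-transfer s t a b eq = begin
  a                  ≡⟨ cong (_xor a) (sym (xor-same s)) ⟩
  (s xor s) xor a    ≡⟨ xor-assoc s s a ⟩
  s xor (s xor a)    ≡⟨ cong (s xor_) eq ⟩
  s xor (t xor b)    ≡⟨ xor-assoc s t b ⟨
  (s xor t) xor b    ∎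
  where open ≡-Reasoning

σ≡signed-row : ∀ {n} (T : Tournament n) (σ : DomRel n) s i →
  SignedAssociated (T ⟨ σ ⟩) s zero (suc i) →
  ∀ k → k ≢ i → σ k ≡ s xor arc T i k
σ≡signed-row T σ s i u≈vᵢ k k≢i = u≈vᵢ (suc k) (λ ()) (k≢i ∘ suc-injective)

signed-rows-associated : ∀ {n} (T : Tournament n) (σ : DomRel n) s t {i j} →
  SignedAssociated (T ⟨ σ ⟩) s zero (suc i) →
  SignedAssociated (T ⟨ σ ⟩) t zero (suc j) →
  SignedAssociated T (s xor t) i j
signed-rows-associated T σ s t {i} {j} u≈vᵢ u≈vⱼ k k≢i k≢j =
  xor-transfer s t (arc T i k) (arc T j k)
    (trans (sym (σ≡signed-row T σ s i u≈vᵢ k k≢i)) (σ≡signed-row T σ t j u≈vⱼ k k≢j))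

proposition3p14 : ∀ (n : ℕ) (T : Tournament n) (σ : DomRel n) → Basic T →
    ∀ (i : Fin n) → CRAssociated (T ⟨ σ ⟩) zero (suc i) →
    ∀ (j : Fin n) → j ≢ i → ¬ CRAssociated (T ⟨ σ ⟩) zero (suc j)
proposition3p14 n T σ (n≥4 , noCR) i u∼vᵢ j j≢i u∼vⱼ
  with s , u≈vᵢ ← CRAssociated⇒signed (T ⟨ σ ⟩) u∼vᵢ
     | t , u≈vⱼ ← CRAssociated⇒signed (T ⟨ σ ⟩) u∼vⱼ
  = noCR i j (signed⇒CRAssociated T (s xor t) (<⇒≤ n≥4) (j≢i ∘ sym)
               (signed-rows-associated T σ s t u≈vᵢ u≈vⱼ))
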